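{- Let $m\in\mathbb N$ and suppose $A_1,\dots,A_m\subset\mathbb N_0$ form an $m$-part sum system. Then for each $j\in\{1,\dots,m\}$, $A_j=(\max A_j)-A_j$, i.e. $x\in A_j$ if and only if $\max A_j-x\in A_j$. Moreover, if all component sets $A_j$ have odd cardinality, then $\max A_j$ is even for every $j$; if at least one component set has even cardinality, then $\max A_j$ is odd for exactly one $j\in\{1,\dots,m\}$.
   Context: $\mathbb N=\{1,2,\dots\}$, $\mathbb N_0=\mathbb N\cup\{0\}$, $\langle N\rangle=\{0,1,\dots,N-1\}$; $A+B=\{x+y:x\in A,y\in B\}$, $c-A=\{c-x:x\in A\}$. An $m$-part sum system is a collection of finite sets $A_1,\dots,A_m\subset\mathbb N_0$, each of cardinality at least 2, with $\sum_{k=1}^mA_k=\langle\prod_{k=1}^m|A_k|\rangle$. -}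

module Defs where

open import Data.Nat using (ℕ; zero; suc; _+_; _*_; _⊔_; _<_; _≤_)
open import Data.Fin using (Fin; zero; suc)
open import Data.List using (List; []; _∷_; length; foldr; cartesianProductWith)
open import Data.List.Membership.Propositional using (_∈_)
open import Data.List.Relation.Unary.Unique.Propositional using (Unique)
open import Data.Product using (_×_; Σ)
open import Function.Bundles using (_⇔_)

-- Finite subsets of ℕ₀ are represented as duplicate-free lists; |A| = length A.

-- Sumset A + B = {x + y : x ∈ A, y ∈ B} (as a list, possibly with repetitions;
-- only membership is ever used).
_⊕_ : List ℕ → List ℕ → List ℕ
A ⊕ B = cartesianProductWith _+_ A B

sumAll : (m : ℕ) → (Fin m → List ℕ) → List ℕ
sumAll zero    A = 0 ∷ []
sumAll (suc m) A = A zero ⊕ sumAll m (λ k → A (suc k))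

prodCard : (m : ℕ) → (Fin m → List ℕ) → ℕ
prodCard zero    A = 1
prodCard (suc m) A = length (A zero) * prodCard m (λ k → A (suc k))

-- Maximum of a list (meaningful for nonempty lists).
maxL : List ℕ → ℕ
maxL = foldr _⊔_ 0

record SumSystem (m : ℕ) (A : Fin m → List ℕ) : Set where
  field
    unique  : ∀ k → Unique (A k)
    card≥2  : ∀ k → 2 ≤ length (A k)
    sumEq   : ∀ n → (n ∈ sumAll m A) ⇔ (n < prodCard m A)

module Submission where

-- IntervalTiling proves de Bruijn's theorem: if P ⊕ Q = [0, N) with unique representations,
-- then P and Q are symmetric.  By induction on N: if 1 ∈ P and d is the least positive
-- element of Q, then P is a union of blocks [s·d, s·d + d), Q ⊆ dℕ and d ∣ N, so dividing
-- by d gives a tiling of [0, N / d) whose symmetry lifts back.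
-- Counting proves a pigeonhole principle: a list of length N covering [0, N) is repetition-free.
-- Sumsets applies both to a sum system: the sumset list has no repetitions, so each Aⱼ tiles
-- [0, N) together with the sum of the other sets, and is symmetric about its maximum.
-- SignedSums studies F L = Σ_{x∈L} (-1)ˣ and G L = Σ_{x∈L} x (-1)ˣ: F is multiplicative and G
-- obeys a Leibniz rule on sumsets, and a symmetric set with odd maximum has F = 0.
-- Parity compares F and G of the sumset with their values on the interval [0, N): for N odd
-- F = 1 rules out odd maxima; for N even the maxima sum to N - 1, so one is odd, and two odd
-- maxima would force G = 0, whereas G [0, 2K) = -K.

module IntervalTiling where

  open import Data.Nat using (ℕ; zero; suc; _+_; _*_; _∸_; _%_; _/_; _≤_; _<_; z≤n; s≤s; _<?_)
  open import Data.Nat.Properties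
  open import Data.Nat.DivMod using (m≡m%n+[m/n]*n; m%n<n)
  open import Data.Nat.Induction using (<-rec)
  open import Data.Nat.Tactic.RingSolver using (solve-∀)
  open import Data.Product using (∃; ∃₂; _×_; _,_; proj₁; proj₂) renaming (swap to ×-swap)
  open import Data.Sum using (_⊎_; inj₁; inj₂; [_,_]′)
  open import Data.Empty using (⊥; ⊥-elim)
  open import Relation.Nullary using (¬_; Dec; yes; no)
  open import Relation.Nullary.Decidable using (_×-dec_)
  open import Relation.Binary.PropositionalEquality

  -- A tiling of the interval [0, N) by two sets P, Q ⊆ ℕ (decidable predicates):
  -- every n < N is a sum a + b with a ∈ P, b ∈ Q, every such sum is < N, and the
  -- representation is unique (equal sums force equal P-summands, hence equal Q-summands).
  record Tiling (P Q : ℕ → Set) (N : ℕ) : Set where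
    field
      P?     : ∀ x → Dec (P x)
      Q?     : ∀ x → Dec (Q x)
      cover  : ∀ n → n < N → ∃₂ λ a b → P a × Q b × a + b ≡ n
      bound  : ∀ {a b} → P a → Q b → a + b < N
      unique : ∀ {a b a′ b′} → P a → Q b → P a′ → Q b′ → a + b ≡ a′ + b′ → a ≡ a′

  -- P is contained in (hence, being finite, equal to) its reflection α - P.
  SymmetricAbout : (ℕ → Set) → ℕ → Set
  SymmetricAbout P α = ∀ x → P x → x ≤ α × P (α ∸ x)

  Symmetric : (ℕ → Set) → Set
  Symmetric P = ∃ (SymmetricAbout P)

  private variable
    P Q : ℕ → Set
    N : ℕ

  zeros : Tiling P Q N → 0 < N → P 0 × Q 0
  zeros {P} {Q} T 0<N =
    let (a , b , pa , qb , a+b≡0) = Tiling.cover T 0 0<N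
    in subst P (m+n≡0⇒m≡0 a a+b≡0) pa , subst Q (m+n≡0⇒n≡0 a a+b≡0) qb

  swap-tiling : Tiling P Q N → Tiling Q P N
  swap-tiling {P} {Q} {N} T = record
    { P? = Q? ; Q? = P?
    ; cover  = λ n n<N → let (a , b , pa , qb , e) = cover n n<N
                         in b , a , qb , pa , trans (+-comm b a) e
    ; bound  = λ {b} {a} qb pa → subst (_< N) (+-comm a b) (bound pa qb)
    ; unique = λ {b} {a} {b′} {a′} qb pa qb′ pa′ e →
        let a≡a′ = unique pa qb pa′ qb′ (trans (+-comm a b) (trans e (+-comm b′ a′)))
        in +-cancelʳ-≡ a b b′ (trans e (cong (b′ +_) (sym a≡a′)))
    }
    where open Tiling T

  trivial-tiling : ∀ {N′} → Tiling P Q (suc N′) → (∀ b → Q b → b ≡ 0) →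
                  Symmetric P × Symmetric Q
  trivial-tiling {P} {Q} {N′} T only-zero = (N′ , P-sym) , (0 , Q-sym)
    where
    open Tiling T
    Q0 : Q 0
    Q0 = proj₂ (zeros T (s≤s z≤n))
    all-in-P : ∀ n → n < suc N′ → P n
    all-in-P n n<N = let (a , b , pa , qb , e) = cover n n<N
                   in subst P (trans (sym (+-identityʳ a)) (trans (cong (a +_) (sym (only-zero b qb))) e)) pa
    P-sym : SymmetricAbout P N′
    P-sym x px = m<1+n⇒m≤n (subst (_< suc N′) (+-identityʳ x) (bound px Q0))
               , all-in-P (N′ ∸ x) (s≤s (m∸n≤m N′ x))
    Q-sym : SymmetricAbout Q 0
    Q-sym x qx rewrite only-zero x qx = z≤n , Q0

  minimise : {R : ℕ → Set} → (∀ x → Dec (R x)) → ∀ n →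
             (∀ k → k < n → ¬ R k) ⊎ ∃ λ k → R k × (∀ j → j < k → ¬ R j)
  minimise R? zero = inj₁ (λ _ ())
  minimise R? (suc n) with minimise R? n
  ... | inj₂ found = inj₂ found
  ... | inj₁ none with R? n
  ...   | yes r = inj₂ (n , r , none)
  ...   | no ¬r = inj₁ λ k k<1+n → [ none k , (λ { refl → ¬r }) ]′ (m<1+n⇒m<n∨m≡n k<1+n)

  -- Then [0, d) ⊆ P, P is a union of blocks [s·d, s·d + d), Q consists of
  -- multiples of d, and N = (q + 1)·d; dividing by d yields a tiling of [0, q + 1) by
  -- P₁ = {s | s·d ∈ P} and Q₁ = {u | u·d ∈ Q}, whose symmetry lifts back to P and Q.
  module Blocks {P Q : ℕ → Set} {N′ : ℕ} (T : Tiling P Q (suc N′)) (P1 : P 1)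
                (d′ : ℕ) (Qd : Q (suc d′)) (d-least : ∀ b → Q b → 0 < b → suc d′ ≤ b) where

    open Tiling T

    d : ℕ
    d = suc d′

    0<d : 0 < d
    0<d = s≤s z≤n

    P0 : P 0
    P0 = proj₁ (zeros T (s≤s z≤n))

    Q0 : Q 0
    Q0 = proj₂ (zeros T (s≤s z≤n))

    P<N : ∀ {a} → P a → a < suc N′
    P<N {a} pa = subst (_< suc N′) (+-identityʳ a) (bound pa Q0)

    -- d ≥ 2: otherwise 1 + 0 and 0 + 1 would be two representations of 1.
    1<d : 1 < d
    1<d = ≤∧≢⇒< 0<d (λ 1≡d → 1+n≢0 (unique P1 Q0 P0 (subst Q (sym 1≡d) Qd) refl))

    -- [0, d) ⊆ P, since below d the only available Q-summand is 0.
    initial-block : ∀ i → i < d → P i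
    initial-block i i<d with cover i (<-trans i<d (bound P0 Qd))
    ... | a , zero , pa , _ , e = subst P (trans (sym (+-identityʳ a)) e) pa
    ... | a , suc b , _ , qb , e =
      ⊥-elim (<⇒≱ i<d (≤-trans (d-least _ qb (s≤s z≤n)) (subst (suc b ≤_) e (m≤n+m (suc b) a))))

    divide : ∀ x → ∃₂ λ q r → r < d × x ≡ q * d + r
    divide x = x / d , x % d , m%n<n x d
             , trans (m≡m%n+[m/n]*n x d) (+-comm (x % d) (x / d * d))

    -- Block k: the point k·d splits as s·d + u·d with u·d ∈ Q, where the P-summand s·d
    -- starts a full block [s·d, s·d + d) ⊆ P.
    Block : ℕ → Set
    Block k = ∃₂ λ s u → Q (u * d) × s + u ≡ k × (∀ i → i < d → P (s * d + i))

    shift : ∀ s u r → s * d + r + u * d ≡ (s + u) * d + r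
    shift s u r = regroup s u d r
      where
      regroup : ∀ s u d r → s * d + r + u * d ≡ (s + u) * d + r
      regroup = solve-∀

    Q-aligned : ∀ {k r} → Block k → r < d → Q (k * d + r) → r ≡ 0
    Q-aligned {r = r} (s , u , qu , refl , block) r<d q =
      m+n≡0⇒n≡0 (s * d) (unique (block r r<d) qu P0 q (shift s u r))

    P-blockwise : ∀ {k r} → Block k → r < d → P (k * d + r) → ∀ i → i < d → P (k * d + i)
    P-blockwise {r = r} (s , u , qu , refl , block) r<d p i i<d =
      subst (λ z → P (z + i)) sd≡kd (block i i<d)
      where
      sd≡kd : s * d ≡ (s + u) * d
      sd≡kd = +-cancelʳ-≡ r _ _
                (unique (block r r<d) qu p Q0 (trans (shift s u r) (sym (+-identityʳ _))))

    -- The hypothesis of the strong induction on k.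
    BlocksBelow : ℕ → Set
    BlocksBelow k = ∀ {s} → s < k → s * d < suc N′ → Block s

    Q-multiple : ∀ {k b} → BlocksBelow k → k * d < suc N′ → Q b → b ≤ k * d →
                 ∃ λ q → q ≤ k × b ≡ q * d
    Q-multiple {k} {b} below kd<N qb b≤kd with divide b
    ... | q , r , r<d , b≡ = q , q≤k , trans b≡ (trans (cong (q * d +_) r≡0) (+-identityʳ _))
      where
      qd≤kd : q * d ≤ k * d
      qd≤kd = ≤-trans (subst (q * d ≤_) (sym b≡) (m≤m+n _ r)) b≤kd
      q≤k : q ≤ k
      q≤k = *-cancelʳ-≤ q k d qd≤kd
      r≡0 : r ≡ 0
      r≡0 with m≤n⇒m<n∨m≡n q≤k
      ... | inj₁ q<k = Q-aligned (below q<k (≤-<-trans qd≤kd kd<N)) r<d (subst Q b≡ qb)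
      ... | inj₂ refl = n≤0⇒n≡0 (+-cancelˡ-≤ (q * d) r 0
                          (subst₂ _≤_ b≡ (sym (+-identityʳ _)) b≤kd))

    -- A positive Q-summand b < k·d in a representation of k·d + i would be a multiple q·d,
    -- making the P-summand (k - q)·d + i and hence (k - q)·d ∈ P; but then k·d has the two
    -- representations (k - q)·d + q·d and k·d + 0.
    no-small-Q : ∀ {k a b i} → BlocksBelow k → P (k * d) → P a → Q b → 0 < b → b < k * d →
               a + b ≡ k * d + i → i < d → ⊥
    no-small-Q {k} {a} {b} {i} below pkd pa qb 0<b b<kd e i<d = <⇒≢ s<k s≡k
      where
      kd<N = P<N pkd
      multiple = Q-multiple below kd<N qb (<⇒≤ b<kd)
      q = proj₁ multiple
      b≡qd : b ≡ q * d
      b≡qd = proj₂ (proj₂ multiple)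
      s = k ∸ q
      s+q≡k : s + q ≡ k
      s+q≡k = m∸n+n≡m (proj₁ (proj₂ multiple))
      s<k : s < k
      s<k = subst (s <_) s+q≡k (m<m+n s (*-cancelʳ-< d 0 q (subst (0 <_) b≡qd 0<b)))
      a≡sd+i : a ≡ s * d + i
      a≡sd+i = +-cancelʳ-≡ (q * d) a (s * d + i) (begin
        a + q * d             ≡⟨ cong (a +_) (sym b≡qd) ⟩
        a + b                 ≡⟨ e ⟩
        k * d + i             ≡⟨ cong (λ z → z * d + i) (sym s+q≡k) ⟩
        (s + q) * d + i       ≡⟨ sym (shift s q i) ⟩
        s * d + i + q * d     ∎)
        where open ≡-Reasoning
      ps : P (s * d + 0)
      ps = P-blockwise (below s<k (≤-<-trans (*-monoˡ-≤ d (<⇒≤ s<k)) kd<N)) i<d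
                       (subst P a≡sd+i pa) 0 0<d
      s≡k : s ≡ k
      s≡k = *-cancelʳ-≡ s k d (trans (sym (+-identityʳ _))
              (unique ps (subst Q b≡qd qb) pkd Q0
                (trans (shift s q 0) (cong (λ z → z * d + 0) s+q≡k))))

    -- A positive Q-summand b = k·d + j ≥ k·d (with j ≤ i < d) is impossible too: j = 0 gives
    -- the two representations k·d + 0 = 0 + b, while j > 0 gives k·d + d = (d - j) + b with
    -- d - j ∈ [0, d) ⊆ P, forcing k·d = d - j < d, so k = 0 and b = j < d.
    no-large-Q : ∀ {k a b i} → P (k * d) → Q b → 0 < b → k * d ≤ b →
               a + b ≡ k * d + i → i < d → ⊥
    no-large-Q {k} {a} {b} {i} pkd qb 0<b kd≤b e i<d with b ∸ k * d in j≡
    ... | zero = <⇒≢ 0<b (sym b≡0)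
      where
      b≡kd : b ≡ k * d
      b≡kd = ≤-antisym (m∸n≡0⇒m≤n j≡) kd≤b
      b≡0 : b ≡ 0
      b≡0 = trans b≡kd (unique pkd Q0 P0 qb (trans (+-identityʳ _) (sym b≡kd)))
    ... | suc j′ = <⇒≱ (subst (_< d) (sym b≡j) (≤-<-trans j≤i i<d)) (d-least b qb 0<b)
      where
      j = suc j′
      kd+j≡b : k * d + j ≡ b
      kd+j≡b = trans (cong (k * d +_) (sym j≡)) (m+[n∸m]≡n kd≤b)
      j≤i : j ≤ i
      j≤i = +-cancelˡ-≤ (k * d) j i
              (subst (_≤ k * d + i) (sym kd+j≡b) (subst (b ≤_) e (m≤n+m b a)))
      j<d : j < d
      j<d = ≤-<-trans j≤i i<d
      d-j<d : d ∸ j < d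
      d-j<d = s≤s (m∸n≤m d′ j′)
      kd≡d-j : k * d ≡ d ∸ j
      kd≡d-j = unique pkd Qd (initial-block (d ∸ j) d-j<d) qb (begin
        k * d + d                 ≡⟨ cong (k * d +_) (sym (m∸n+n≡m (<⇒≤ j<d))) ⟩
        k * d + (d ∸ j + j)       ≡⟨ regroup (d ∸ j) j (k * d) ⟩
        d ∸ j + (k * d + j)       ≡⟨ cong (d ∸ j +_) kd+j≡b ⟩
        d ∸ j + b                 ∎)
        where
        open ≡-Reasoning
        regroup : ∀ x y z → z + (x + y) ≡ x + (z + y)
        regroup = solve-∀
      k≡0 : k ≡ 0
      k≡0 = n<1⇒n≡0 (*-cancelʳ-< d k 1 (subst₂ _<_ (sym kd≡d-j) (sym (*-identityˡ d)) d-j<d))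
      b≡j : b ≡ j
      b≡j = trans (sym kd+j≡b) (cong (λ z → z * d + j) k≡0)

    -- A block whose start k·d lies in P lies entirely in P: in a representation of k·d + i
    -- the Q-summand must be 0.
    fill : ∀ {k} → BlocksBelow k → P (k * d) → ∀ i → i < d → P (k * d + i)
    fill {k} below pkd i i<d with cover (k * d + i) (<-trans (+-monoʳ-< (k * d) i<d) (bound pkd Qd))
    ... | a , zero , pa , _ , e = subst P (trans (sym (+-identityʳ a)) e) pa
    ... | a , suc b , pa , qb , e with suc b <? k * d
    ...   | yes b<kd = ⊥-elim (no-small-Q {k} below pkd pa qb (s≤s z≤n) b<kd e i<d)
    ...   | no b≮kd = ⊥-elim (no-large-Q {k} pkd qb (s≤s z≤n) (≮⇒≥ b≮kd) e i<d)

    -- Every point k·d < N is a block, by strong induction on k: in k·d = a + b the summand b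
    -- is a multiple q·d, so a = (k - q)·d; for q = 0 the block is filled by `fill`, otherwise
    -- it is the earlier block k - q.
    next-block : ∀ {k} → BlocksBelow k → k * d < suc N′ → Block k
    next-block {k} below kd<N with cover (k * d) kd<N
    ... | a , b , pa , qb , e with Q-multiple below kd<N qb (subst (b ≤_) e (m≤n+m b a))
    ...   | zero , _ , refl =
      k , 0 , Q0 , +-identityʳ k , fill below (subst P (trans (sym (+-identityʳ a)) e) pa)
    ...   | q@(suc _) , q≤k , refl = s , q , qb , s+q≡k , P-blockwise (below s<k sd<N) 0<d ps
      where
      s = k ∸ q
      s+q≡k : s + q ≡ k
      s+q≡k = m∸n+n≡m q≤k
      s<k : s < k
      s<k = subst (s <_) s+q≡k (m<m+n s (s≤s z≤n))
      sd<N : s * d < suc N′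
      sd<N = ≤-<-trans (*-monoˡ-≤ d (<⇒≤ s<k)) kd<N
      ps : P (s * d + 0)
      ps = subst P (+-cancelʳ-≡ (q * d) a (s * d + 0)
             (trans e (trans (cong (_* d) (sym s+q≡k))
               (trans (sym (+-identityʳ _)) (sym (shift s q 0)))))) pa

    all-blocks : ∀ k → k * d < suc N′ → Block k
    all-blocks = <-rec _ (λ k below → next-block below)

    P-decompose : ∀ {a} → P a → ∃₂ λ s r → r < d × a ≡ s * d + r × P (s * d)
    P-decompose {a} pa with divide a
    ... | s , r , r<d , a≡ = s , r , r<d , a≡ , subst P (+-identityʳ _) p0
      where
      p0 : P (s * d + 0)
      p0 = P-blockwise (all-blocks s (≤-<-trans (subst (s * d ≤_) (sym a≡) (m≤m+n _ r)) (P<N pa)))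
                       r<d (subst P a≡ pa) 0 0<d

    block-of : ∀ s → P (s * d) → ∀ i → i < d → P (s * d + i)
    block-of s ps = P-blockwise {s} (all-blocks s (P<N ps)) 0<d (subst P (sym (+-identityʳ _)) ps)

    Q-decompose : ∀ {b} → Q b → ∃ λ u → b ≡ u * d
    Q-decompose {b} qb with divide b
    ... | u , r , r<d , b≡ = u , trans b≡ (trans (cong (u * d +_) r≡0) (+-identityʳ _))
      where
      r≡0 : r ≡ 0
      r≡0 = Q-aligned (all-blocks u (≤-<-trans (subst (u * d ≤_) (sym b≡) (m≤m+n _ r)) (bound P0 qb)))
                      r<d (subst Q b≡ qb)

    -- The interval consists of whole blocks: N = (q + 1)·d.  Indeed N - 1 = q·d + r lies in
    -- the block q = s + u, whose last point (s·d + d - 1) + u·d = q·d + d - 1 is below N.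
    block-count : ∃ λ q → suc N′ ≡ suc q * d
    block-count with divide N′
    ... | q , r , r<d , N′≡ with all-blocks q (s≤s (subst (q * d ≤_) (sym N′≡) (m≤m+n _ r)))
    ...   | s , u , qu , s+u≡q , block = q , (begin
      suc N′              ≡⟨ cong suc N′≡ ⟩
      suc (q * d + r)     ≡⟨ cong (λ z → suc (q * d + z)) r≡d′ ⟩
      suc (q * d + d′)    ≡⟨ regroup q d′ ⟩
      suc q * d           ∎)
      where
      open ≡-Reasoning
      regroup : ∀ q d′ → suc (q * suc d′ + d′) ≡ suc q * suc d′
      regroup = solve-∀
      last-point : q * d + d′ < suc N′
      last-point = subst (_< suc N′) (trans (shift s u d′) (cong (λ z → z * d + d′) s+u≡q))
                        (bound (block d′ (n<1+n d′)) qu)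
      r≡d′ : r ≡ d′
      r≡d′ = ≤-antisym (m<1+n⇒m≤n r<d)
               (+-cancelˡ-≤ (q * d) d′ r (subst (q * d + d′ ≤_) N′≡ (m<1+n⇒m≤n last-point)))

    q : ℕ
    q = proj₁ block-count

    N≡ : suc N′ ≡ suc q * d
    N≡ = proj₂ block-count

    P₁ Q₁ : ℕ → Set
    P₁ s = P (s * d)
    Q₁ u = Q (u * d)

    reduced : Tiling P₁ Q₁ (suc q)
    reduced = record
      { P?     = λ s → P? (s * d)
      ; Q?     = λ u → Q? (u * d)
      ; cover  = λ n n≤q →
          let (s , u , qu , s+u≡n , block) = all-blocks n (subst (n * d <_) (sym N≡) (*-monoˡ-< d n≤q))
          in s , u , subst P (+-identityʳ _) (block 0 0<d) , qu , s+u≡n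
      ; bound  = λ {s} {u} ps qu →
          *-cancelʳ-< d (s + u) (suc q) (≤-<-trans (m≤m+n _ d′)
            (subst₂ _<_ (shift s u d′) N≡ (bound (block-of s ps d′ (n<1+n d′)) qu)))
      ; unique = λ {s} {u} {s′} {u′} ps qu ps′ qu′ e → *-cancelʳ-≡ s s′ d
          (unique ps qu ps′ qu′ (trans (sym (*-distribʳ-+ d s u))
                                       (trans (cong (_* d) e) (*-distribʳ-+ d s′ u′))))
      }

    reduced<N : suc q < suc N′
    reduced<N = subst (suc q <_) (sym N≡) (m<m*n (suc q) d 1<d)

    lift : Symmetric P₁ × Symmetric Q₁ → Symmetric P × Symmetric Q
    lift ((α , P₁-sym) , (β , Q₁-sym)) = (α * d + d′ , P-sym) , (β * d , Q-sym)
      where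
      P-sym : SymmetricAbout P (α * d + d′)
      P-sym x px with P-decompose px
      ... | s , r , r<d , refl , ps =
        +-mono-≤ (*-monoˡ-≤ d s≤α) r≤d′ ,
        subst P (sym reflection) (block-of (α ∸ s) pα-s (d′ ∸ r) (s≤s (m∸n≤m d′ r)))
        where
        s≤α = proj₁ (P₁-sym s ps)
        pα-s = proj₂ (P₁-sym s ps)
        r≤d′ : r ≤ d′
        r≤d′ = m<1+n⇒m≤n r<d
        reflection : α * d + d′ ∸ (s * d + r) ≡ (α ∸ s) * d + (d′ ∸ r)
        reflection = begin
          α * d + d′ ∸ (s * d + r)                                  ≡⟨ cong (_∸ (s * d + r)) split ⟩
          (s * d + r) + ((α ∸ s) * d + (d′ ∸ r)) ∸ (s * d + r)      ≡⟨ m+n∸m≡n (s * d + r) _ ⟩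
          (α ∸ s) * d + (d′ ∸ r)                                    ∎
          where
          open ≡-Reasoning
          regroup : ∀ s t r e d → (s + t) * d + (r + e) ≡ (s * d + r) + (t * d + e)
          regroup = solve-∀
          split : α * d + d′ ≡ (s * d + r) + ((α ∸ s) * d + (d′ ∸ r))
          split = trans (cong₂ (λ a b → a * d + b) (sym (m+[n∸m]≡n s≤α)) (sym (m+[n∸m]≡n r≤d′)))
                        (regroup s (α ∸ s) r (d′ ∸ r) d)
      Q-sym : SymmetricAbout Q (β * d)
      Q-sym x qx with Q-decompose qx
      ... | u , refl = *-monoˡ-≤ d (proj₁ (Q₁-sym u qx))
                     , subst Q (*-distribʳ-∸ d β u) (proj₂ (Q₁-sym u qx))

  SymmetricTiles : ℕ → Set₁
  SymmetricTiles N = ∀ {P Q} → Tiling P Q N → 0 < N → Symmetric P × Symmetric Q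

  -- The inductive step when 1 ∈ P: either Q = {0}, or Q has a least positive element d
  -- and the block structure reduces the problem to the shorter interval [0, N / d).
  with-one-in-P : ∀ {N′} → (∀ {M} → M < suc N′ → SymmetricTiles M) →
               Tiling P Q (suc N′) → P 1 → Symmetric P × Symmetric Q
  with-one-in-P {P} {Q} {N′} shorter T P1
    with minimise (λ b → (0 <? b) ×-dec Tiling.Q? T b) (suc N′)
  ... | inj₁ no-positive = trivial-tiling T only-zero
    where
    only-zero : ∀ b → Q b → b ≡ 0
    only-zero zero _ = refl
    only-zero (suc b) qb = ⊥-elim (no-positive (suc b) (Tiling.bound T P0 qb) (s≤s z≤n , qb))
      where P0 = proj₁ (zeros T (s≤s z≤n))
  ... | inj₂ (suc d′ , (_ , Qd) , smaller) =
    lift (shorter reduced<N reduced (s≤s z≤n))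
    where
    d-least : ∀ b → Q b → 0 < b → suc d′ ≤ b
    d-least b qb 0<b = ≮⇒≥ (λ b<d → smaller b b<d (0<b , qb))
    open Blocks T P1 d′ Qd d-least

  tiling-symmetric : ∀ N → SymmetricTiles N
  tiling-symmetric = <-rec SymmetricTiles step
    where
    step : ∀ N → (∀ {M} → M < N → SymmetricTiles M) → SymmetricTiles N
    step zero _ _ ()
    step (suc zero) _ T _ =
      trivial-tiling T (λ b qb → n<1⇒n≡0 (Tiling.bound T (proj₁ (zeros T (s≤s z≤n))) qb))
    step (suc (suc N″)) shorter T _ with Tiling.cover T 1 (s≤s (s≤s z≤n))
    ... | suc zero , zero , P1 , _ , refl = with-one-in-P shorter T P1
    ... | zero , suc zero , _ , Q1 , refl = ×-swap (with-one-in-P shorter (swap-tiling T) Q1)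

module Counting where

  open import Data.Nat using (ℕ; zero; suc; _+_; _≤_; _<_; z≤n; s≤s; _≟_; _<?_)
  open import Data.Nat.Properties
  open import Data.Nat.Tactic.RingSolver using (solve-∀)
  open import Data.List using (List; []; _∷_; length)
  open import Data.List.Membership.Propositional using (_∈_; _∉_)
  open import Data.List.Relation.Unary.Any using (here; there)
  open import Data.List.Relation.Unary.All as All using (All; []; _∷_)
  open import Data.List.Relation.Unary.AllPairs using ([]; _∷_)
  open import Data.List.Relation.Unary.Unique.Propositional using (Unique)
  open import Data.Sum using (inj₁; inj₂)
  open import Relation.Nullary using (yes; no; contradiction)
  open import Relation.Binary.PropositionalEquality

  δ : ℕ → ℕ → ℕ
  δ n x with n ≟ x
  ... | yes _ = 1
  ... | no _  = 0

  δ-same : ∀ n → δ n n ≡ 1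
  δ-same n with n ≟ n
  ... | yes _  = refl
  ... | no n≢n = contradiction refl n≢n

  δ-diff : ∀ {n x} → n ≢ x → δ n x ≡ 0
  δ-diff {n} {x} n≢x with n ≟ x
  ... | yes n≡x = contradiction n≡x n≢x
  ... | no _    = refl

  occ : ℕ → List ℕ → ℕ
  occ n []      = 0
  occ n (x ∷ L) = δ n x + occ n L

  occ-∈ : ∀ {n L} → n ∈ L → 1 ≤ occ n L
  occ-∈ {n} {_ ∷ L} (here refl) = subst (λ z → 1 ≤ z + occ n L) (sym (δ-same n)) (s≤s z≤n)
  occ-∈ {n} {x ∷ L} (there n∈L)  = ≤-trans (occ-∈ n∈L) (m≤n+m (occ n L) (δ n x))

  occ-∉ : ∀ {n L} → n ∉ L → occ n L ≡ 0
  occ-∉ {L = []}    _   = refl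
  occ-∉ {L = x ∷ L} n∉L rewrite δ-diff (λ n≡x → n∉L (here n≡x)) = occ-∉ (λ n∈L → n∉L (there n∈L))

  occ-unique : ∀ {n L} → Unique L → n ∈ L → occ n L ≡ 1
  occ-unique {n} (x∉L ∷ _) (here refl) rewrite δ-same n = cong suc (occ-∉ (λ n∈L → All.lookup x∉L n∈L refl))
  occ-unique {n} {x ∷ L} (x∉L ∷ L!) (there n∈L)
    rewrite δ-diff (λ n≡x → All.lookup x∉L n∈L (sym n≡x)) = occ-unique L! n∈L

  occ≤1⇒unique : ∀ L → (∀ n → occ n L ≤ 1) → Unique L
  occ≤1⇒unique []      _     = []
  occ≤1⇒unique (x ∷ L) occ≤1 =
    All.tabulate (λ y∈L x≡y → x∉L (subst (_∈ L) (sym x≡y) y∈L))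
    ∷ occ≤1⇒unique L (λ n → ≤-trans (m≤n+m (occ n L) (δ n x)) (occ≤1 n))
    where
    x∉L : x ∉ L
    x∉L x∈L = <⇒≱ (subst (λ z → 1 < z + occ x L) (sym (δ-same x)) (s≤s (occ-∈ x∈L))) (occ≤1 x)

  sumBelow : ℕ → (ℕ → ℕ) → ℕ
  sumBelow zero    f = 0
  sumBelow (suc N) f = sumBelow N f + f N

  sumBelow-+ : ∀ N f g → sumBelow N (λ n → f n + g n) ≡ sumBelow N f + sumBelow N g
  sumBelow-+ zero    f g = refl
  sumBelow-+ (suc N) f g rewrite sumBelow-+ N f g = regroup (sumBelow N f) (sumBelow N g) (f N) (g N)
    where
    regroup : ∀ a b c d → a + b + (c + d) ≡ a + c + (b + d)
    regroup = solve-∀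

  sumBelow-δ-≥ : ∀ {x} N → N ≤ x → sumBelow N (λ n → δ n x) ≡ 0
  sumBelow-δ-≥ zero    _   = refl
  sumBelow-δ-≥ (suc N) N<x rewrite sumBelow-δ-≥ N (<⇒≤ N<x) | δ-diff (<⇒≢ N<x) = refl

  sumBelow-δ : ∀ {x} N → x < N → sumBelow N (λ n → δ n x) ≡ 1
  sumBelow-δ {x} (suc N) x<1+N with m<1+n⇒m<n∨m≡n x<1+N
  ... | inj₁ x<N  rewrite sumBelow-δ N x<N | δ-diff (≢-sym (<⇒≢ x<N)) = refl
  ... | inj₂ refl rewrite sumBelow-δ-≥ x ≤-refl | δ-same x = refl

  sumBelow-occ : ∀ N L → All (_< N) L → sumBelow N (λ n → occ n L) ≡ length L
  sumBelow-occ N []      []          = sumBelow-zero N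
    where
    sumBelow-zero : ∀ N → sumBelow N (λ _ → 0) ≡ 0
    sumBelow-zero zero    = refl
    sumBelow-zero (suc N) = cong (_+ 0) (sumBelow-zero N)
  sumBelow-occ N (x ∷ L) (x<N ∷ L<N) =
    trans (sumBelow-+ N (λ n → δ n x) (λ n → occ n L))
          (cong₂ _+_ (sumBelow-δ N x<N) (sumBelow-occ N L L<N))

  sumBelow-lower : ∀ N f → (∀ n → n < N → 1 ≤ f n) → N ≤ sumBelow N f
  sumBelow-lower zero    f pos = z≤n
  sumBelow-lower (suc N) f pos = subst (_≤ sumBelow N f + f N) (+-comm N 1)
    (+-mono-≤ (sumBelow-lower N f (λ n n<N → pos n (m<n⇒m<1+n n<N))) (pos N (n<1+n N)))

  sumBelow-excess : ∀ N f → (∀ n → n < N → 1 ≤ f n) → ∀ k → k < N → f k + N ≤ suc (sumBelow N f)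
  sumBelow-excess (suc N) f pos k k<1+N with m<1+n⇒m<n∨m≡n k<1+N
  ... | inj₁ k<N  = begin
    f k + suc N               ≡⟨ +-suc (f k) N ⟩
    suc (f k + N)             ≤⟨ s≤s (sumBelow-excess N f pos′ k k<N) ⟩
    suc (suc (sumBelow N f))  ≤⟨ s≤s (subst (_≤ sumBelow N f + f N) (+-comm (sumBelow N f) 1)
                                            (+-monoʳ-≤ (sumBelow N f) (pos N (n<1+n N)))) ⟩
    suc (sumBelow N f + f N)  ∎
    where
    open ≤-Reasoning
    pos′ = λ n n<N → pos n (m<n⇒m<1+n n<N)
  ... | inj₂ refl = begin
    f k + suc k               ≡⟨ trans (+-suc (f k) k) (cong suc (+-comm (f k) k)) ⟩
    suc (k + f k)             ≤⟨ s≤s (+-monoˡ-≤ (f k) (sumBelow-lower k f (λ n n<k → pos n (m<n⇒m<1+n n<k)))) ⟩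
    suc (sumBelow k f + f k)  ∎
    where open ≤-Reasoning

  pigeonhole : ∀ N L → (∀ n → n < N → n ∈ L) → All (_< N) L → length L ≡ N → Unique L
  pigeonhole N L covers L<N length≡N = occ≤1⇒unique L occ≤1
    where
    occ≤1 : ∀ n → occ n L ≤ 1
    occ≤1 n with n <? N
    ... | no n≮N  = subst (_≤ 1) (sym (occ-∉ (λ n∈L → n≮N (All.lookup L<N n∈L)))) z≤n
    ... | yes n<N = +-cancelʳ-≤ N (occ n L) 1 (subst (occ n L + N ≤_) (cong suc sum≡N)
                     (sumBelow-excess N (λ m → occ m L) (λ m m<N → occ-∈ (covers m m<N)) n n<N))
      where sum≡N = trans (sumBelow-occ N L L<N) length≡N

module Sumsets where

  open import Defs
  open IntervalTiling
  open Counting using (pigeonhole)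
  open import Data.Nat using (ℕ; zero; suc; _+_; _*_; _∸_; _⊔_; _≤_; _<_; z≤n; s≤s)
  open import Data.Nat.Properties
  open import Data.Nat.Tactic.RingSolver using (solve-∀)
  open import Data.Fin using (Fin; zero; suc) renaming (_≟_ to _≟ᶠ_)
  open import Data.Vec.Functional using (updateAt)
  open import Data.Vec.Functional.Properties using (updateAt-updates; updateAt-minimal)
  open import Data.List using (List; []; _∷_; length; map; _++_)
  open import Data.List.Properties using (length-++; length-map)
  open import Data.List.Membership.Propositional using (_∈_; _∉_)
  open import Data.List.Membership.Propositional.Properties
    using (∈-cartesianProductWith⁺; ∈-cartesianProductWith⁻; ∈-map⁺; ∈-++⁺ˡ; ∈-++⁺ʳ)
  open import Data.List.Membership.DecPropositional _≟_ using (_∈?_)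
  open import Data.List.Relation.Unary.Any using (here; there)
  open import Data.List.Relation.Unary.All as All using ()
  open import Data.List.Relation.Unary.AllPairs using ([]; _∷_)
  open import Data.List.Relation.Unary.Unique.Propositional using (Unique)
  open import Data.List.Relation.Unary.Unique.Propositional.Properties using (map⁻)
  open import Data.Product using (∃; _×_; _,_; proj₁; proj₂)
  open import Function using (const)
  open import Function.Bundles using (_⇔_; mk⇔; Equivalence)
  open import Relation.Nullary using (yes; no; contradiction)
  open import Relation.Binary.PropositionalEquality

  sumFin : (M : ℕ) → (Fin M → ℕ) → ℕ
  sumFin zero    c = 0
  sumFin (suc M) c = c zero + sumFin M (λ k → c (suc k))

  Choice : (M : ℕ) → (Fin M → List ℕ) → (Fin M → ℕ) → Set
  Choice M A c = ∀ k → c k ∈ A k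

  choice∈sumAll : ∀ M A c → Choice M A c → sumFin M c ∈ sumAll M A
  choice∈sumAll zero    A c _      = here refl
  choice∈sumAll (suc M) A c choice = ∈-cartesianProductWith⁺ _+_ (choice zero)
    (choice∈sumAll M (λ k → A (suc k)) (λ k → c (suc k)) (λ k → choice (suc k)))

  sumAll⇒choice : ∀ M A {n} → n ∈ sumAll M A → ∃ λ c → Choice M A c × sumFin M c ≡ n
  sumAll⇒choice zero    A (here refl) = (λ ()) , (λ ()) , refl
  sumAll⇒choice (suc M) A n∈
    with a , b , a∈ , b∈ , refl ← ∈-cartesianProductWith⁻ _+_ (A zero) (sumAll M (λ k → A (suc k))) n∈
    with c , choice , refl ← sumAll⇒choice M (λ k → A (suc k)) b∈
    = (λ { zero → a ; (suc k) → c k }) , (λ { zero → a∈ ; (suc k) → choice k }) , refl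

  length-⊕ : ∀ xs ys → length (xs ⊕ ys) ≡ length xs * length ys
  length-⊕ []       ys = refl
  length-⊕ (x ∷ xs) ys = trans (length-++ (map (x +_) ys))
                               (cong₂ _+_ (length-map (x +_) ys) (length-⊕ xs ys))

  length-sumAll : ∀ M A → length (sumAll M A) ≡ prodCard M A
  length-sumAll zero    A = refl
  length-sumAll (suc M) A = trans (length-⊕ (A zero) _)
                                  (cong (length (A zero) *_) (length-sumAll M (λ k → A (suc k))))

  ++-uniqueˡ : ∀ xs {ys : List ℕ} → Unique (xs ++ ys) → Unique xs
  ++-uniqueˡ []       _            = []
  ++-uniqueˡ (x ∷ xs) (x∉ ∷ xs!) =
    All.tabulate (λ v∈xs → All.lookup x∉ (∈-++⁺ˡ v∈xs)) ∷ ++-uniqueˡ xs xs!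

  ++-uniqueʳ : ∀ xs {ys : List ℕ} → Unique (xs ++ ys) → Unique ys
  ++-uniqueʳ []       ys!          = ys!
  ++-uniqueʳ (x ∷ xs) (_ ∷ xs!) = ++-uniqueʳ xs xs!

  ++-disjoint : ∀ xs {ys : List ℕ} {v} → Unique (xs ++ ys) → v ∈ xs → v ∉ ys
  ++-disjoint (x ∷ xs) (x∉ ∷ _)   (here refl) v∈ys = All.lookup x∉ (∈-++⁺ʳ xs v∈ys) refl
  ++-disjoint (x ∷ xs) (_ ∷ xs!) (there v∈xs) v∈ys = ++-disjoint xs xs! v∈xs v∈ys

  ⊕-unique : ∀ xs ys {a b a′ b′} → Unique (xs ⊕ ys) → a ∈ xs → a′ ∈ xs → b ∈ ys → b′ ∈ ys →
             a + b ≡ a′ + b′ → a ≡ a′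
  ⊕-unique (x ∷ xs) ys u (here refl) (here refl) _ _ _ = refl
  ⊕-unique (x ∷ xs) ys u (here refl) (there a′∈) b∈ b′∈ e = contradiction
    (subst (_∈ xs ⊕ ys) (sym e) (∈-cartesianProductWith⁺ _+_ a′∈ b′∈))
    (++-disjoint (map (x +_) ys) u (∈-map⁺ (x +_) b∈))
  ⊕-unique (x ∷ xs) ys u (there a∈) (here refl) b∈ b′∈ e = contradiction
    (subst (_∈ xs ⊕ ys) e (∈-cartesianProductWith⁺ _+_ a∈ b∈))
    (++-disjoint (map (x +_) ys) u (∈-map⁺ (x +_) b′∈))
  ⊕-unique (x ∷ xs) ys u (there a∈) (there a′∈) b∈ b′∈ e =
    ⊕-unique xs ys (++-uniqueʳ (map (x +_) ys) u) a∈ a′∈ b∈ b′∈ e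

  ⊕-uniqueʳ : ∀ xs ys {a} → a ∈ xs → Unique (xs ⊕ ys) → Unique ys
  ⊕-uniqueʳ (x ∷ _) ys _ u = map⁻ (++-uniqueˡ (map (x +_) ys) u)

  choice-unique : ∀ M A c c′ → Unique (sumAll M A) → Choice M A c → Choice M A c′ →
                  sumFin M c ≡ sumFin M c′ → ∀ k → c k ≡ c′ k
  choice-unique (suc M) A c c′ u choice choice′ e = λ { zero → head≡ ; (suc k) → tail≡ k }
    where
    rest = sumAll M (λ k → A (suc k))
    head≡ : c zero ≡ c′ zero
    head≡ = ⊕-unique (A zero) rest u (choice zero) (choice′ zero)
              (choice∈sumAll M _ _ (λ k → choice (suc k))) (choice∈sumAll M _ _ (λ k → choice′ (suc k))) e
    tail≡ : ∀ k → c (suc k) ≡ c′ (suc k)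
    tail≡ = choice-unique M (λ k → A (suc k)) (λ k → c (suc k)) (λ k → c′ (suc k))
              (⊕-uniqueʳ (A zero) rest (choice zero) u) (λ k → choice (suc k)) (λ k → choice′ (suc k))
              (+-cancelˡ-≡ (c zero) _ _ (trans e (cong (_+ _) (sym head≡))))

  sumFin-mono : ∀ M (c c′ : Fin M → ℕ) → (∀ k → c k ≤ c′ k) → sumFin M c ≤ sumFin M c′
  sumFin-mono zero    c c′ _    = z≤n
  sumFin-mono (suc M) c c′ c≤c′ = +-mono-≤ (c≤c′ zero) (sumFin-mono M _ _ (λ k → c≤c′ (suc k)))

  sumFin-update : ∀ M (c : Fin M → ℕ) j x → sumFin M (updateAt c j (const x)) + c j ≡ x + sumFin M c
  sumFin-update (suc M) c zero    x = regroup x (sumFin M (λ k → c (suc k))) (c zero)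
    where
    regroup : ∀ a b c → a + b + c ≡ a + (c + b)
    regroup = solve-∀
  sumFin-update (suc M) c (suc j) x = begin
    c zero + sumFin M c′ + c (suc j)    ≡⟨ +-assoc (c zero) _ _ ⟩
    c zero + (sumFin M c′ + c (suc j))  ≡⟨ cong (c zero +_) (sumFin-update M (λ k → c (suc k)) j x) ⟩
    c zero + (x + sumFin M tail)        ≡⟨ +-comm-left (c zero) x _ ⟩
    x + (c zero + sumFin M tail)        ∎
    where
    open ≡-Reasoning
    tail = λ k → c (suc k)
    c′ = updateAt tail j (const x)
    +-comm-left : ∀ a b c → a + (b + c) ≡ b + (a + c)
    +-comm-left = solve-∀

  rechoose : ∀ {M} {A : Fin M → List ℕ} {c} j {x} →
             (∀ k → k ≢ j → c k ∈ A k) → x ∈ A j → Choice M A (updateAt c j (const x))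
  rechoose {A = A} {c} j others x∈ k with k ≟ᶠ j
  ... | yes refl = subst (_∈ A k) (sym (updateAt-updates k c)) x∈
  ... | no k≢j   = subst (_∈ A k) (sym (updateAt-minimal k j c k≢j)) (others k k≢j)

  maxL-upper : ∀ {x} L → x ∈ L → x ≤ maxL L
  maxL-upper (y ∷ L) (here refl) = m≤m⊔n y (maxL L)
  maxL-upper (y ∷ L) (there x∈L) = ≤-trans (maxL-upper L x∈L) (m≤n⊔m y (maxL L))

  maxL-least : ∀ {α} L → (∀ x → x ∈ L → x ≤ α) → maxL L ≤ α
  maxL-least []      _     = z≤n
  maxL-least (y ∷ L) bound = ⊔-lub (bound y (here refl)) (maxL-least L (λ x x∈L → bound x (there x∈L)))

  symmetric-max : ∀ {L α} → SymmetricAbout (_∈ L) α → 0 ∈ L → maxL L ≡ α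
  symmetric-max {L} L-sym 0∈L =
    ≤-antisym (maxL-least L (λ x x∈L → proj₁ (L-sym x x∈L))) (maxL-upper L (proj₂ (L-sym 0 0∈L)))

  reflection⇔ : ∀ {L α} → SymmetricAbout (_∈ L) α → ∀ x → (x ∈ L) ⇔ (∃ λ y → y ∈ L × x + y ≡ α)
  reflection⇔ {L} {α} L-sym x = mk⇔
    (λ x∈L → α ∸ x , proj₂ (L-sym x x∈L) , m+[n∸m]≡n (proj₁ (L-sym x x∈L)))
    (λ { (y , y∈L , refl) → subst (_∈ L) (m+n∸n≡m x y) (proj₂ (L-sym y y∈L)) })

  prodCard-pos : ∀ M A → (∀ k → 0 < length (A k)) → 0 < prodCard M A
  prodCard-pos zero    A _   = s≤s z≤n
  prodCard-pos (suc M) A pos = *-mono-≤ (pos zero) (prodCard-pos M (λ k → A (suc k)) (λ k → pos (suc k)))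

  module SumSystemFacts {m : ℕ} {A : Fin (suc m) → List ℕ} (S : SumSystem (suc m) A) where
    open SumSystem S

    M N : ℕ
    M = suc m
    N = prodCard M A

    in-interval : ∀ {n} → n ∈ sumAll M A → n < N
    in-interval {n} = Equivalence.to (sumEq n)

    in-sumset : ∀ {n} → n < N → n ∈ sumAll M A
    in-sumset {n} = Equivalence.from (sumEq n)

    0<N : 0 < N
    0<N = prodCard-pos M A (λ k → ≤-trans (s≤s z≤n) (card≥2 k))

    -- The sumset list has length N and covers [0, N), so it has no repetitions:
    -- every element of the sum system has exactly one representation.
    sumAll-unique : Unique (sumAll M A)
    sumAll-unique = pigeonhole N (sumAll M A) (λ n → in-sumset) (All.tabulate in-interval) (length-sumAll M A)

    -- Aⱼ tiles [0, N) together with the sum of all the other sets, obtained by replacing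
    -- Aⱼ with {0}.
    module Complement (j : Fin M) where

      A′ : Fin M → List ℕ
      A′ = updateAt A j (const (0 ∷ []))

      others : List ℕ
      others = sumAll M A′

      vanishes : ∀ {c} → Choice M A′ c → c j ≡ 0
      vanishes {c} choice with subst (c j ∈_) (updateAt-updates j A) (choice j)
      ... | here c[j]≡0 = c[j]≡0

      toA′ : ∀ {c} → Choice M A c → Choice M A′ (updateAt c j (const 0))
      toA′ choice = rechoose j (λ k k≢j → subst (_ ∈_) (sym (updateAt-minimal k j A k≢j)) (choice k))
                               (subst (0 ∈_) (sym (updateAt-updates j A)) (here refl))

      toA : ∀ {c a} → Choice M A′ c → a ∈ A j → Choice M A (updateAt c j (const a))
      toA choice a∈ = rechoose j (λ k k≢j → subst (_ ∈_) (updateAt-minimal k j A k≢j) (choice k)) a∈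

      sum-toA : ∀ {c} a → Choice M A′ c → sumFin M (updateAt c j (const a)) ≡ a + sumFin M c
      sum-toA {c} a choice = begin
        updated          ≡⟨ sym (+-identityʳ updated) ⟩
        updated + 0      ≡⟨ cong (updated +_) (sym (vanishes choice)) ⟩
        updated + c j    ≡⟨ sumFin-update M c j a ⟩
        a + sumFin M c   ∎
        where
        open ≡-Reasoning
        updated = sumFin M (updateAt c j (const a))

      tiling : Tiling (_∈ A j) (_∈ others) N
      tiling = record
        { P?     = _∈? A j
        ; Q?     = _∈? others
        ; cover  = λ n n<N →
            let (c , choice , sum≡n) = sumAll⇒choice M A (in-sumset n<N)
            in c j , sumFin M (updateAt c j (const 0)) , choice j
             , choice∈sumAll M A′ _ (toA′ choice)
             , trans (+-comm (c j) _) (trans (sumFin-update M c j 0) sum≡n)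
        ; bound  = λ {a} a∈ b∈ →
            let (c , choice , sum≡b) = sumAll⇒choice M A′ b∈
            in subst (_< N) (trans (sum-toA a choice) (cong (a +_) sum≡b))
                     (in-interval (choice∈sumAll M A _ (toA choice a∈)))
        ; unique = λ {a} {b} {a′} {b′} a∈ b∈ a′∈ b′∈ e →
            let (c , choice , sum≡b) = sumAll⇒choice M A′ b∈
                (c′ , choice′ , sum≡b′) = sumAll⇒choice M A′ b′∈
                sums≡ = begin
                  sumFin M (updateAt c j (const a))   ≡⟨ sum-toA a choice ⟩
                  a + sumFin M c                      ≡⟨ cong (a +_) sum≡b ⟩
                  a + b                               ≡⟨ e ⟩
                  a′ + b′                             ≡⟨ cong (a′ +_) (sym sum≡b′) ⟩
                  a′ + sumFin M c′                    ≡⟨ sym (sum-toA a′ choice′) ⟩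
                  sumFin M (updateAt c′ j (const a′)) ∎
            in trans (sym (updateAt-updates j c))
                 (trans (choice-unique M A _ _ sumAll-unique (toA choice a∈) (toA choice′ a′∈) sums≡ j)
                        (updateAt-updates j c′))
        }
        where open ≡-Reasoning

    zero∈ : ∀ j → 0 ∈ A j
    zero∈ j = proj₁ (zeros (Complement.tiling j) 0<N)

    -- Each Aⱼ is symmetric about its maximum, by de Bruijn's theorem for the tiling
    -- of [0, N) by Aⱼ and the sum of the other sets.
    symmetric : ∀ j → SymmetricAbout (_∈ A j) (maxL (A j))
    symmetric j = subst (SymmetricAbout (_∈ A j)) (sym (symmetric-max Aj-sym (zero∈ j))) Aj-sym
      where
      Aj-sym = proj₂ (proj₁ (tiling-symmetric N (Complement.tiling j) 0<N))

    maxima : Fin M → ℕ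
    maxima k = maxL (A k)

    maxima-choice : Choice M A maxima
    maxima-choice k = proj₂ (symmetric k 0 (zero∈ k))

    maxima-sum : suc (sumFin M maxima) ≡ N
    maxima-sum = ≤-antisym (in-interval (choice∈sumAll M A maxima maxima-choice)) N≤
      where
      -- N - 1 is the sum of a choice, which is bounded by the maxima.
      N-1≤ : N ∸ 1 ≤ sumFin M maxima
      N-1≤ = let (c , choice , sum≡N-1) = sumAll⇒choice M A (in-sumset (∸-monoʳ-< {o = 0} (s≤s z≤n) 0<N))
             in subst (_≤ sumFin M maxima) sum≡N-1
                      (sumFin-mono M c maxima (λ k → maxL-upper (A k) (choice k)))
      N≤ : N ≤ suc (sumFin M maxima)
      N≤ = ≤-trans (m≤n+m∸n N 1) (s≤s N-1≤)

module SignedSums where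

  open import Defs using (_⊕_; sumAll)
  open IntervalTiling using (SymmetricAbout)
  open Counting using (δ; δ-same; δ-diff; occ; occ-∉; occ-unique)
  open import Data.Nat as ℕ using (ℕ; zero; suc; _%_; _∸_)
  open import Data.Fin using (Fin; zero; suc)
  import Data.Nat.Properties as ℕ
  open import Data.Integer using (ℤ; +_; -_; -[1+_]; _+_; _*_; 0ℤ; 1ℤ; -1ℤ)
  open import Data.Integer.Properties
    using ( +-identityˡ; +-identityʳ; +-assoc; +-comm; *-identityˡ; *-identityʳ; *-assoc
          ; *-zeroˡ; *-zeroʳ; *-distribʳ-+; neg-involutive; neg-distrib-+; neg-distribʳ-*; -1*i≡-i)
  open import Data.Integer.Tactic.RingSolver using (solve-∀)
  open import Data.List using (List; []; _∷_; map; _++_)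
  open import Data.List.Membership.Propositional using (_∈_)
  open import Data.List.Membership.DecPropositional ℕ._≟_ using (_∈?_)
  open import Data.List.Relation.Unary.All as All using (All; []; _∷_)
  open import Data.List.Relation.Unary.Unique.Propositional using (Unique)
  open import Data.Product using (_×_; _,_; proj₁; proj₂)
  open import Data.Sum using (_⊎_; inj₁; inj₂)
  open import Relation.Nullary using (yes; no; contradiction)
  open import Relation.Binary.PropositionalEquality

  sign : ℕ → ℤ
  sign zero    = 1ℤ
  sign (suc n) = - sign n

  sign-+ : ∀ a b → sign (a ℕ.+ b) ≡ sign a * sign b
  sign-+ zero    b = sym (unit (sign b))
    where
    unit : ∀ x → 1ℤ * x ≡ x
    unit = solve-∀
  sign-+ (suc a) b = trans (cong -_ (sign-+ a b)) (neg-* (sign a) (sign b))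
    where
    neg-* : ∀ x y → - (x * y) ≡ (- x) * y
    neg-* = solve-∀

  parity : ∀ n → (n % 2 ≡ 0 × sign n ≡ 1ℤ) ⊎ (n % 2 ≡ 1 × sign n ≡ -1ℤ)
  parity zero          = inj₁ (refl , refl)
  parity (suc zero)    = inj₂ (refl , refl)
  parity (suc (suc n)) with parity n
  ... | inj₁ (even , s) = inj₁ (even , trans (neg-involutive (sign n)) s)
  ... | inj₂ (odd , s)  = inj₂ (odd , trans (neg-involutive (sign n)) s)

  odd⇒sign : ∀ n → n % 2 ≡ 1 → sign n ≡ -1ℤ
  odd⇒sign n odd with parity n
  ... | inj₁ (even , _) = contradiction (trans (sym even) odd) λ ()
  ... | inj₂ (_ , s)    = s

  sign⇒odd : ∀ n → sign n ≡ -1ℤ → n % 2 ≡ 1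
  sign⇒odd n s with parity n
  ... | inj₁ (_ , s′)  = contradiction (trans (sym s′) s) λ ()
  ... | inj₂ (odd , _) = odd

  sign-square : ∀ n → sign n * sign n ≡ 1ℤ
  sign-square n with parity n
  ... | inj₁ (_ , s) rewrite s = refl
  ... | inj₂ (_ , s) rewrite s = refl

  weighted : (ℕ → ℤ) → List ℕ → ℤ
  weighted w []      = 0ℤ
  weighted w (x ∷ L) = w x + weighted w L

  weighted-++ : ∀ w xs ys → weighted w (xs ++ ys) ≡ weighted w xs + weighted w ys
  weighted-++ w []       ys = sym (+-identityˡ (weighted w ys))
  weighted-++ w (x ∷ xs) ys = trans (cong (_+_ (w x)) (weighted-++ w xs ys)) (sym (+-assoc (w x) _ _))

  weighted-shift : ∀ x w (a b : ℤ) u v → (∀ y → w (x ℕ.+ y) ≡ a * u y + b * v y) →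
                   ∀ L → weighted w (map (x ℕ.+_) L) ≡ a * weighted u L + b * weighted v L
  weighted-shift x w a b u v split []      = sym (vanish a b)
    where
    vanish : ∀ a b → a * 0ℤ + b * 0ℤ ≡ 0ℤ
    vanish = solve-∀
  weighted-shift x w a b u v split (y ∷ L) rewrite split y | weighted-shift x w a b u v split L =
    regroup a b (u y) (v y) (weighted u L) (weighted v L)
    where
    regroup : ∀ a b p q r s → a * p + b * q + (a * r + b * s) ≡ a * (p + r) + b * (q + s)
    regroup = solve-∀

  -- F L = Σ_{x ∈ L} (-1)ˣ and G L = Σ_{x ∈ L} x (-1)ˣ are the values at -1 of the generating
  -- polynomial Σ_{x ∈ L} tˣ of L and of t times its derivative.  Being evaluations of a
  -- product of polynomials and of its derivative, they satisfy the product and Leibniz rules.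
  F G : List ℕ → ℤ
  F = weighted sign
  G = weighted (λ n → + n * sign n)

  F-⊕ : ∀ xs ys → F (xs ⊕ ys) ≡ F xs * F ys
  F-⊕ []       ys = refl
  F-⊕ (x ∷ xs) ys = begin
    F (map (x ℕ.+_) ys ++ xs ⊕ ys)
      ≡⟨ weighted-++ sign (map (x ℕ.+_) ys) _ ⟩
    F (map (x ℕ.+_) ys) + F (xs ⊕ ys)
      ≡⟨ cong₂ _+_ (weighted-shift x sign (sign x) 0ℤ sign sign shift ys) (F-⊕ xs ys) ⟩
    sign x * F ys + 0ℤ * F ys + F xs * F ys
      ≡⟨ regroup (sign x) (F xs) (F ys) ⟩
    (sign x + F xs) * F ys
      ∎
    where
    open ≡-Reasoning
    regroup : ∀ a b c → a * c + 0ℤ * c + b * c ≡ (a + b) * c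
    regroup = solve-∀
    pad : ∀ a b → a * b ≡ a * b + 0ℤ * b
    pad = solve-∀
    shift : ∀ y → sign (x ℕ.+ y) ≡ sign x * sign y + 0ℤ * sign y
    shift y = trans (sign-+ x y) (pad (sign x) (sign y))

  G-⊕ : ∀ xs ys → G (xs ⊕ ys) ≡ G xs * F ys + F xs * G ys
  G-⊕ []       ys = sym (vanish (F ys) (G ys))
    where
    vanish : ∀ a b → 0ℤ * a + 0ℤ * b ≡ 0ℤ
    vanish = solve-∀
  G-⊕ (x ∷ xs) ys = begin
    G (map (x ℕ.+_) ys ++ xs ⊕ ys)
      ≡⟨ weighted-++ _ (map (x ℕ.+_) ys) _ ⟩
    G (map (x ℕ.+_) ys) + G (xs ⊕ ys)
      ≡⟨ cong₂ _+_ (weighted-shift x _ (+ x * sign x) (sign x) sign _ leibniz ys) (G-⊕ xs ys) ⟩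
    (+ x * sign x) * F ys + sign x * G ys + (G xs * F ys + F xs * G ys)
      ≡⟨ regroup (+ x * sign x) (sign x) (F ys) (G ys) (G xs) (F xs) ⟩
    (+ x * sign x + G xs) * F ys + (sign x + F xs) * G ys
      ∎
    where
    open ≡-Reasoning
    regroup : ∀ a b p q r s → a * p + b * q + (r * p + s * q) ≡ (a + r) * p + (b + s) * q
    regroup = solve-∀
    expand : ∀ a b c d → (a + b) * (c * d) ≡ a * c * d + c * (b * d)
    expand = solve-∀
    leibniz : ∀ y → + (x ℕ.+ y) * sign (x ℕ.+ y) ≡ (+ x * sign x) * sign y + sign x * (+ y * sign y)
    leibniz y rewrite sign-+ x y = expand (+ x) (+ y) (sign x) (sign y)

  F-sumAll : ∀ M A i → F (A i) ≡ 0ℤ → F (sumAll M A) ≡ 0ℤ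
  F-sumAll (suc M) A zero    F≡0 = trans (F-⊕ (A zero) _) (cong (_* F (sumAll M (λ k → A (suc k)))) F≡0)
  F-sumAll (suc M) A (suc i) F≡0 = trans (F-⊕ (A zero) _)
    (trans (cong (F (A zero) *_) (F-sumAll M (λ k → A (suc k)) i F≡0)) (*-zeroʳ (F (A zero))))

  G-⊕-vanishes : ∀ xs ys → F xs ≡ 0ℤ → F ys ≡ 0ℤ → G (xs ⊕ ys) ≡ 0ℤ
  G-⊕-vanishes xs ys Fxs≡0 Fys≡0 rewrite G-⊕ xs ys | Fxs≡0 | Fys≡0 = vanish (G xs) (G ys)
    where
    vanish : ∀ a b → a * 0ℤ + 0ℤ * b ≡ 0ℤ
    vanish = solve-∀

  G-sumAll : ∀ M A i j → i ≢ j → F (A i) ≡ 0ℤ → F (A j) ≡ 0ℤ → G (sumAll M A) ≡ 0ℤ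
  G-sumAll (suc M) A zero    zero    i≢j _ _ = contradiction refl i≢j
  G-sumAll (suc M) A zero    (suc j) _ F₀≡0 Fⱼ≡0 =
    G-⊕-vanishes (A zero) _ F₀≡0 (F-sumAll M (λ k → A (suc k)) j Fⱼ≡0)
  G-sumAll (suc M) A (suc i) zero    _ Fᵢ≡0 F₀≡0 =
    G-⊕-vanishes (A zero) _ F₀≡0 (F-sumAll M (λ k → A (suc k)) i Fᵢ≡0)
  G-sumAll (suc M) A (suc i) (suc j) i≢j Fᵢ≡0 Fⱼ≡0
    rewrite G-⊕ (A zero) (sumAll M (λ k → A (suc k))) | F-sumAll M (λ k → A (suc k)) i Fᵢ≡0
          | G-sumAll M (λ k → A (suc k)) i j (λ i≡j → i≢j (cong suc i≡j)) Fᵢ≡0 Fⱼ≡0 =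
    vanish (G (A zero)) (F (A zero))
    where
    vanish : ∀ a b → a * 0ℤ + b * 0ℤ ≡ 0ℤ
    vanish = solve-∀

  intervalSum : ℕ → (ℕ → ℤ) → ℤ
  intervalSum zero    w = 0ℤ
  intervalSum (suc N) w = intervalSum N w + w N

  intervalSum-cong : ∀ N {v w} → (∀ n → n ℕ.< N → v n ≡ w n) → intervalSum N v ≡ intervalSum N w
  intervalSum-cong zero    _  = refl
  intervalSum-cong (suc N) v≡w =
    cong₂ _+_ (intervalSum-cong N (λ n n<N → v≡w n (ℕ.m<n⇒m<1+n n<N))) (v≡w N (ℕ.n<1+n N))

  intervalSum-+ : ∀ N v w → intervalSum N (λ n → v n + w n) ≡ intervalSum N v + intervalSum N w
  intervalSum-+ zero    v w = refl
  intervalSum-+ (suc N) v w rewrite intervalSum-+ N v w =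
    regroup (intervalSum N v) (intervalSum N w) (v N) (w N)
    where
    regroup : ∀ a b c d → a + b + (c + d) ≡ a + c + (b + d)
    regroup = solve-∀

  intervalSum-neg : ∀ N w → intervalSum N (λ n → - w n) ≡ - intervalSum N w
  intervalSum-neg zero    w = refl
  intervalSum-neg (suc N) w rewrite intervalSum-neg N w = sym (neg-distrib-+ (intervalSum N w) (w N))

  intervalSum-first : ∀ K w → intervalSum (suc K) w ≡ w 0 + intervalSum K (λ n → w (suc n))
  intervalSum-first zero    w = +-comm 0ℤ (w 0)
  intervalSum-first (suc K) w rewrite intervalSum-first K w = +-assoc (w 0) _ (w (suc K))

  intervalSum-reverse : ∀ K w → intervalSum (suc K) w ≡ intervalSum (suc K) (λ n → w (K ∸ n))
  intervalSum-reverse zero    w = refl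
  intervalSum-reverse (suc K) w = begin
    intervalSum (suc K) w + w (suc K)                  ≡⟨ cong (_+ w (suc K)) (intervalSum-reverse K w) ⟩
    intervalSum (suc K) (λ n → w (K ∸ n)) + w (suc K)  ≡⟨ +-comm _ (w (suc K)) ⟩
    w (suc K) + intervalSum (suc K) (λ n → w (K ∸ n))  ≡⟨ sym (intervalSum-first (suc K) (λ n → w (suc K ∸ n))) ⟩
    intervalSum (suc (suc K)) (λ n → w (suc K ∸ n))    ∎
    where open ≡-Reasoning

  δ-vanishes : ∀ {n x} (w : ℕ → ℤ) → δ n x ≡ 0 → + δ n x * w n ≡ 0ℤ
  δ-vanishes {n} w δ≡0 = trans (cong (λ z → + z * w n) δ≡0) (*-zeroˡ (w n))

  intervalSum-δ-≥ : ∀ {x} N (w : ℕ → ℤ) → x ℕ.≥ N → intervalSum N (λ n → + δ n x * w n) ≡ 0ℤ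
  intervalSum-δ-≥ zero    w _   = refl
  intervalSum-δ-≥ (suc N) w N<x =
    cong₂ _+_ (intervalSum-δ-≥ N w (ℕ.<⇒≤ N<x)) (δ-vanishes w (δ-diff (ℕ.<⇒≢ N<x)))

  intervalSum-δ : ∀ {x} N (w : ℕ → ℤ) → x ℕ.< N → intervalSum N (λ n → + δ n x * w n) ≡ w x
  intervalSum-δ {x} (suc N) w x<1+N with ℕ.m<1+n⇒m<n∨m≡n x<1+N
  ... | inj₁ x<N  = trans (cong₂ _+_ (intervalSum-δ N w x<N) (δ-vanishes w (δ-diff (≢-sym (ℕ.<⇒≢ x<N)))))
                          (+-identityʳ (w x))
  ... | inj₂ refl = trans (cong₂ _+_ (intervalSum-δ-≥ x w ℕ.≤-refl) (cong (λ z → + z * w x) (δ-same x)))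
                          (trans (+-identityˡ _) (*-identityˡ (w x)))

  weighted-occ : ∀ N w L → All (ℕ._< N) L → weighted w L ≡ intervalSum N (λ n → + occ n L * w n)
  weighted-occ N w []      []          = sym (zeros N)
    where
    zeros : ∀ N → intervalSum N (λ n → + 0 * w n) ≡ 0ℤ
    zeros zero    = refl
    zeros (suc N) rewrite zeros N = trans (+-identityˡ _) (*-zeroˡ (w N))
  weighted-occ N w (x ∷ L) (x<N ∷ L<N) = begin
    w x + weighted w L
      ≡⟨ cong₂ _+_ (sym (intervalSum-δ N w x<N)) (weighted-occ N w L L<N) ⟩
    intervalSum N (λ n → + δ n x * w n) + intervalSum N (λ n → + occ n L * w n)
      ≡⟨ sym (intervalSum-+ N _ _) ⟩
    intervalSum N (λ n → + δ n x * w n + + occ n L * w n)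
      ≡⟨ intervalSum-cong N (λ n _ → sym (*-distribʳ-+ (w n) (+ δ n x) (+ occ n L))) ⟩
    intervalSum N (λ n → + occ n (x ∷ L) * w n)
      ∎
    where open ≡-Reasoning

  weighted-interval : ∀ N w L → Unique L → All (ℕ._< N) L → (∀ n → n ℕ.< N → n ∈ L) →
                      weighted w L ≡ intervalSum N w
  weighted-interval N w L L! L<N covers = trans (weighted-occ N w L L<N)
    (intervalSum-cong N (λ n n<N → trans (cong (λ z → + z * w n) (occ-unique L! (covers n n<N)))
                                         (*-identityˡ (w n))))

  -- A repetition-free list symmetric about an odd centre α has F L = 0: the reflection
  -- n ↦ α - n preserves multiplicities and flips the sign (-1)ⁿ.
  F-symmetric-odd : ∀ {α} L → Unique L → SymmetricAbout (_∈ L) α → α % 2 ≡ 1 → F L ≡ 0ℤ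
  F-symmetric-odd {α} L L! L-sym α-odd = self-negating (begin
    F L                                    ≡⟨ F-as-sum ⟩
    intervalSum (suc α) h                  ≡⟨ intervalSum-reverse α h ⟩
    intervalSum (suc α) (λ n → h (α ∸ n))  ≡⟨ intervalSum-cong (suc α) (λ n n≤α → h-reflect n (ℕ.m<1+n⇒m≤n n≤α)) ⟩
    intervalSum (suc α) (λ n → - h n)      ≡⟨ intervalSum-neg (suc α) h ⟩
    - intervalSum (suc α) h                ≡⟨ cong -_ (sym F-as-sum) ⟩
    - F L                                  ∎)
    where
    open ≡-Reasoning
    h : ℕ → ℤ
    h n = + occ n L * sign n
    F-as-sum = weighted-occ (suc α) sign L (All.tabulate (λ x∈L → ℕ.s≤s (proj₁ (L-sym _ x∈L))))
    occ-reflect : ∀ n → n ℕ.≤ α → occ (α ∸ n) L ≡ occ n L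
    occ-reflect n n≤α with n ∈? L
    ... | yes n∈L = trans (occ-unique L! (proj₂ (L-sym n n∈L))) (sym (occ-unique L! n∈L))
    ... | no n∉L  = trans (occ-∉ α-n∉L) (sym (occ-∉ n∉L))
      where
      α-n∉L = λ α-n∈L → n∉L (subst (_∈ L) (ℕ.m∸[m∸n]≡n n≤α) (proj₂ (L-sym _ α-n∈L)))
    sign-reflect : ∀ n → n ℕ.≤ α → sign (α ∸ n) ≡ - sign n
    sign-reflect n n≤α = begin
      sign (α ∸ n)                            ≡⟨ sym (*-identityʳ _) ⟩
      sign (α ∸ n) * 1ℤ                       ≡⟨ cong (sign (α ∸ n) *_) (sym (sign-square n)) ⟩
      sign (α ∸ n) * (sign n * sign n)        ≡⟨ sym (*-assoc (sign (α ∸ n)) _ _) ⟩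
      sign (α ∸ n) * sign n * sign n          ≡⟨ cong (_* sign n) (sym (sign-+ (α ∸ n) n)) ⟩
      sign (α ∸ n ℕ.+ n) * sign n             ≡⟨ cong (λ z → sign z * sign n) (ℕ.m∸n+n≡m n≤α) ⟩
      sign α * sign n                         ≡⟨ cong (_* sign n) (odd⇒sign α α-odd) ⟩
      -1ℤ * sign n                            ≡⟨ -1*i≡-i (sign n) ⟩
      - sign n                                ∎
    h-reflect : ∀ n → n ℕ.≤ α → h (α ∸ n) ≡ - h n
    h-reflect n n≤α rewrite occ-reflect n n≤α | sign-reflect n n≤α = sym (neg-distribʳ-* (+ occ n L) (sign n))
    self-negating : ∀ {x} → x ≡ - x → x ≡ 0ℤ
    self-negating {+ zero}    _ = refl
    self-negating {+ suc _}   ()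
    self-negating { -[1+ _ ]} ()

  sign-even : ∀ K → sign (K ℕ.* 2) ≡ 1ℤ
  sign-even zero    = refl
  sign-even (suc K) = trans (neg-involutive _) (sign-even K)

  F-interval-even : ∀ K → intervalSum (K ℕ.* 2) sign ≡ 0ℤ
  F-interval-even zero    = refl
  F-interval-even (suc K) rewrite F-interval-even K | sign-even K = refl

  F-interval-odd : ∀ K → intervalSum (suc (K ℕ.* 2)) sign ≡ 1ℤ
  F-interval-odd K rewrite F-interval-even K | sign-even K = refl

  G-interval-even : ∀ K → intervalSum (K ℕ.* 2) (λ n → + n * sign n) ≡ - + K
  G-interval-even zero    = refl
  G-interval-even (suc K) rewrite G-interval-even K | sign-even K = step (+ (K ℕ.* 2)) (+ K)
    where
    step : ∀ a k → - k + a * 1ℤ + (1ℤ + a) * - 1ℤ ≡ - (1ℤ + k)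
    step = solve-∀

module Parity where

  open import Defs
  open Sumsets
  open SignedSums
  open import Data.Nat as ℕ using (ℕ; zero; suc; _%_; _/_)
  import Data.Nat.Properties as ℕ
  open import Data.Nat.DivMod using (m≡m%n+[m/n]*n; %-distribˡ-*)
  open import Data.Integer using (+_; -_; _*_; 0ℤ; 1ℤ; -1ℤ)
  open import Data.Integer.Properties using (*-identityˡ; neg-involutive)
  open import Data.Fin using (Fin; zero; suc) renaming (_≟_ to _≟ᶠ_)
  open import Data.List using (List; length)
  open import Data.List.Relation.Unary.All as All using ()
  open import Data.Product using (∃; _×_; _,_; proj₁; proj₂)
  open import Data.Sum using (inj₁; inj₂)
  open import Relation.Nullary using (yes; no; contradiction)
  open import Relation.Binary.PropositionalEquality

  parity-* : ∀ a b → (a ℕ.* b) % 2 ≡ ((a % 2) ℕ.* (b % 2)) % 2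
  parity-* a b = %-distribˡ-* a b 2

  prodCard-odd : ∀ M A → (∀ k → length (A k) % 2 ≡ 1) → prodCard M A % 2 ≡ 1
  prodCard-odd zero    A _   = refl
  prodCard-odd (suc M) A odd
    rewrite parity-* (length (A zero)) (prodCard M (λ k → A (suc k)))
          | odd zero | prodCard-odd M (λ k → A (suc k)) (λ k → odd (suc k)) = refl

  prodCard-even : ∀ M A k → length (A k) % 2 ≡ 0 → prodCard M A % 2 ≡ 0
  prodCard-even (suc M) A zero    even
    rewrite parity-* (length (A zero)) (prodCard M (λ k → A (suc k))) | even = refl
  prodCard-even (suc M) A (suc k) even
    rewrite parity-* (length (A zero)) (prodCard M (λ k → A (suc k)))
          | prodCard-even M (λ k → A (suc k)) k even | ℕ.*-zeroʳ (length (A zero) % 2) = refl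

  odd-summand : ∀ M c → sign (sumFin M c) ≡ -1ℤ → ∃ λ k → sign (c k) ≡ -1ℤ
  odd-summand (suc M) c odd with parity (c zero)
  ... | inj₂ (_ , c₀-odd)  = zero , c₀-odd
  ... | inj₁ (_ , c₀-even) = let (k , odd-k) = odd-summand M tail tail-odd in suc k , odd-k
    where
    open ≡-Reasoning
    tail = λ k → c (suc k)
    tail-odd : sign (sumFin M tail) ≡ -1ℤ
    tail-odd = begin
      sign (sumFin M tail)                  ≡⟨ sym (*-identityˡ _) ⟩
      1ℤ * sign (sumFin M tail)             ≡⟨ cong (_* sign (sumFin M tail)) (sym c₀-even) ⟩
      sign (c zero) * sign (sumFin M tail)  ≡⟨ sym (sign-+ (c zero) _) ⟩
      sign (sumFin (suc M) c)               ≡⟨ odd ⟩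
      -1ℤ                                   ∎

  halve : ∀ n → n ≡ n % 2 ℕ.+ n / 2 ℕ.* 2
  halve n = m≡m%n+[m/n]*n n 2

  module SumSystemParity {m : ℕ} {A : Fin (suc m) → List ℕ} (S : SumSystem (suc m) A) where
    open SumSystem S
    open SumSystemFacts S

    F-odd-max : ∀ j → maxL (A j) % 2 ≡ 1 → F (A j) ≡ 0ℤ
    F-odd-max j odd = F-symmetric-odd (A j) (unique j) (symmetric j) odd

    sumset-interval : ∀ w → weighted w (sumAll M A) ≡ intervalSum N w
    sumset-interval w = weighted-interval N w (sumAll M A) sumAll-unique
                          (All.tabulate in-interval) (λ n → in-sumset)

    -- If all |Aₖ| are odd then N = 2K + 1 is odd, so F (sumset) = 1 ≠ 0 and no maximum is odd.
    all-odd⇒even-maxima : (∀ k → length (A k) % 2 ≡ 1) → ∀ j → maxL (A j) % 2 ≡ 0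
    all-odd⇒even-maxima odd j with parity (maxL (A j))
    ... | inj₁ (even , _)    = even
    ... | inj₂ (max-odd , _) = contradiction (begin
      0ℤ                                    ≡⟨ sym (F-sumAll M A j (F-odd-max j max-odd)) ⟩
      F (sumAll M A)                        ≡⟨ sumset-interval sign ⟩
      intervalSum N sign                    ≡⟨ cong (λ n → intervalSum n sign) N≡2K+1 ⟩
      intervalSum (suc (N / 2 ℕ.* 2)) sign  ≡⟨ F-interval-odd (N / 2) ⟩
      1ℤ                                    ∎) λ ()
      where
      open ≡-Reasoning
      N≡2K+1 : N ≡ suc (N / 2 ℕ.* 2)
      N≡2K+1 = trans (halve N) (cong (ℕ._+ N / 2 ℕ.* 2) (prodCard-odd M A odd))

    -- If some |Aₖ| is even then N = 2K is even: the maxima sum to the odd number N - 1, so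
    -- one of them is odd; two odd maxima would make G (sumset) = 0, but G [0, 2K) = -K ≠ 0.
    some-even⇒one-odd-maximum : (∃ λ k → length (A k) % 2 ≡ 0) →
      ∃ λ j → maxL (A j) % 2 ≡ 1 × (∀ j′ → maxL (A j′) % 2 ≡ 1 → j′ ≡ j)
    some-even⇒one-odd-maximum (k , even) = j , j-odd , only-j
      where
      K = N / 2
      N≡2K : N ≡ K ℕ.* 2
      N≡2K = trans (halve N) (cong (ℕ._+ K ℕ.* 2) (prodCard-even M A k even))
      sum-odd : sign (sumFin M maxima) ≡ -1ℤ
      sum-odd = trans (sym (neg-involutive _))
                      (cong -_ (trans (cong sign (trans maxima-sum N≡2K)) (sign-even K)))
      odd-max = odd-summand M maxima sum-odd
      j = proj₁ odd-max
      j-odd : maxL (A j) % 2 ≡ 1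
      j-odd = sign⇒odd (maxL (A j)) (proj₂ odd-max)
      only-j : ∀ j′ → maxL (A j′) % 2 ≡ 1 → j′ ≡ j
      only-j j′ j′-odd with j′ ≟ᶠ j
      ... | yes j′≡j = j′≡j
      ... | no j′≢j  = contradiction (begin
        0ℤ                       ≡⟨ sym (G-sumAll M A j′ j j′≢j (F-odd-max j′ j′-odd) (F-odd-max j j-odd)) ⟩
        G (sumAll M A)           ≡⟨ sumset-interval g ⟩
        intervalSum N g          ≡⟨ cong (λ n → intervalSum n g) N≡2K ⟩
        intervalSum (K ℕ.* 2) g  ≡⟨ G-interval-even K ⟩
        - + K                    ∎) (K≢0 K refl)
        where
        open ≡-Reasoning
        g = λ n → + n * sign n
        K≢0 : ∀ K′ → K′ ≡ K → 0ℤ ≢ - + K′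
        K≢0 zero    K≡0 _ = ℕ.<⇒≢ 0<N (sym (trans N≡2K (cong (ℕ._* 2) (sym K≡0))))
        K≢0 (suc _) _   ()

open import Defs
open import Data.Nat using (ℕ; suc; _+_; _%_)
open import Data.Fin using (Fin)
open import Data.List using (List; length)
open import Data.List.Membership.Propositional using (_∈_)
open import Data.Product using (_×_; ∃; _,_)
open import Function.Bundles using (_⇔_)
open import Relation.Binary.PropositionalEquality using (_≡_)
open Sumsets using (module SumSystemFacts; reflection⇔)
open Parity using (module SumSystemParity)

theorem1 : (m : ℕ) → (A : Fin (suc m) → List ℕ) → SumSystem (suc m) A →
    ((j : Fin (suc m)) → (x : ℕ) → (x ∈ A j) ⇔ (∃ λ y → y ∈ A j × x + y ≡ maxL (A j)))
    × (((k : Fin (suc m)) → length (A k) % 2 ≡ 1) → (j : Fin (suc m)) → maxL (A j) % 2 ≡ 0)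
    × ((∃ λ k → length (A k) % 2 ≡ 0) →
        ∃ λ j → maxL (A j) % 2 ≡ 1 × ((j′ : Fin (suc m)) → maxL (A j′) % 2 ≡ 1 → j′ ≡ j))
theorem1 m A S = (λ j → reflection⇔ (symmetric j)) , all-odd⇒even-maxima , some-even⇒one-odd-maximum
  where
  open SumSystemFacts S
  open SumSystemParity S
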